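{- There is an instance $({\sf K},p)$ of the two-way-comparison search tree problem such that, on this instance, Spuler's algorithm (described in the context) computes, for some subproblem $(I,h)$ of its dynamic program, a tree $t^*(I,h)$ that is not of minimum cost among all trees for $(I,H)$ with $H\subseteq I$, $|H|=h$. In particular, Spuler's recurrence is incorrect for some subproblems.
   Context: An instance $({\sf K},p)$ consists of keys ${\sf K}=\{1,\dots,n\}$ with non-negative weights $p_k$. A two-way-comparison search tree for a query set $S\subseteq{\sf K}$ is a rooted binary tree in which each internal node has two children and is labeled by a key $k\in{\sf K}$ and an operator, either equality ($v=k$?) or less-than ($v<k$?); it has $|S|$ leaves, each labeled by a distinct element of $S$. The search for a query $v$ starts at the root and at each internal node follows the "yes" or "no" child according to the outcome of the comparison; the tree is correct if for every $v\in S$ the search ends at the leaf labeled $v$. Its cost is $\sum_{v\in S}p_v\cdot\mathrm{depth}(v)$, and its weight is $\sum_{v\in S}p_v$. For an interval $I=[i,j]=\{i,\dots,j\}$ and integer $h$, a subproblem $(I,h)$ asks for a minimum-cost correct tree for query set $I\setminus H$ over all $H\subseteq I$ with $|H|=h$. Spuler's algorithm computes for each subproblem $(I,h)$, $I=[i,j]$, a tree $t^*(I,h)$ with cost $c(I,h)$. If $|I|-h=1$ the tree is a single leaf (cost $0$). If $|I|-h>1$: (1) an equality candidate is formed: let $e$ be a least-weight key of $I$ that is not a leaf of $t^*(I,h+1)$; the candidate has root "$v=e$?" with yes-child the leaf $e$ and no-subtree $t^*(I,h+1)$; (2) for every $s\in I$ and $h_1,h_2\ge 0$ with $h_1+h_2=h$,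 $s-i-h_1\ge1$ and $j-s+1-h_2\ge1$, a less-than candidate is formed with root "$v<s$?" and subtrees $t^*([i,s-1],h_1)$ and $t^*([s,j],h_2)$; (3) $t^*(I,h)$ is a minimum-cost candidate, where a candidate's cost is its weight plus the costs of its two subtrees. The final answer is $t^*({\sf K},0)$. -}

module Defs where

open import Data.Nat using (ℕ; zero; suc; _+_; _*_; _∸_; _≤_; _<_; _≡ᵇ_; _<ᵇ_)
open import Data.Bool using (if_then_else_)
open import Data.List using (List; []; _∷_; _++_; map; upTo; length)
open import Data.List.Membership.Propositional using (_∈_; _∉_)
open import Data.List.Relation.Unary.All using (All)
open import Data.List.Relation.Binary.Permutation.Propositional using (_↭_)
open import Data.List.Relation.Binary.Sublist.Propositional using (_⊆_)
open import Data.Product using (Σ; ∃; _×_; _,_)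
open import Data.Sum using (_⊎_)
open import Relation.Binary.PropositionalEquality using (_≡_)

-- Two-way-comparison search trees.  In a node, the first subtree is the
-- "yes" child and the second subtree is the "no" child.
data Tree : Set where
  leaf : ℕ → Tree
  eqN  : ℕ → Tree → Tree → Tree
  ltN  : ℕ → Tree → Tree → Tree

leaves : Tree → List ℕ
leaves (leaf a)    = a ∷ []
leaves (eqN k y n) = leaves y ++ leaves n
leaves (ltN k y n) = leaves y ++ leaves n

nodeKeys : Tree → List ℕ
nodeKeys (leaf a)    = []
nodeKeys (eqN k y n) = k ∷ (nodeKeys y ++ nodeKeys n)
nodeKeys (ltN k y n) = k ∷ (nodeKeys y ++ nodeKeys n)

search : Tree → ℕ → ℕ
search (leaf a)    v = a
search (eqN k y n) v = if v ≡ᵇ k then search y v else search n v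
search (ltN k y n) v = if v <ᵇ k then search y v else search n v

costAt : (ℕ → ℕ) → ℕ → Tree → ℕ
costAt p d (leaf a)    = d * p a
costAt p d (eqN k y n) = costAt p (suc d) y + costAt p (suc d) n
costAt p d (ltN k y n) = costAt p (suc d) y + costAt p (suc d) n

cost : (ℕ → ℕ) → Tree → ℕ
cost p = costAt p 0

InK : ℕ → ℕ → Set
InK n k = 1 ≤ k × k ≤ n

CorrectFor : ℕ → Tree → List ℕ → Set
CorrectFor n T S =
  All (InK n) (nodeKeys T) × (leaves T ↭ S) × (∀ v → v ∈ S → search T v ≡ v)

interval : ℕ → ℕ → List ℕ
interval i j = map (i +_) (upTo (suc j ∸ i))

-- Spuler's algorithm, as a specification of the table t i j h = t*([i,j],h).
-- Subproblems: 1 ≤ i, j ≤ n, h + i ≤ j (i.e. |I| - h ≥ 1).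

LeastNonLeaf : (ℕ → ℕ) → ℕ → ℕ → Tree → ℕ → Set
LeastNonLeaf p i j T e =
  i ≤ e × e ≤ j × e ∉ leaves T ×
  (∀ e' → i ≤ e' → e' ≤ j → e' ∉ leaves T → p e ≤ p e')

IsCandidate : (ℕ → ℕ) → (ℕ → ℕ → ℕ → Tree) → ℕ → ℕ → ℕ → Tree → Set
IsCandidate p t i j h T =
  (∃ λ e → LeastNonLeaf p i j (t i j (suc h)) e × T ≡ eqN e (leaf e) (t i j (suc h)))
  ⊎
  (∃ λ s → ∃ λ h₁ → ∃ λ h₂ →
     i ≤ s × s ≤ j × h₁ + h₂ ≡ h ×
     suc (i + h₁) ≤ s ×          -- s - i - h₁ ≥ 1
     h₂ + s ≤ j ×                -- j - s + 1 - h₂ ≥ 1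
     T ≡ ltN s (t i (s ∸ 1) h₁) (t s j h₂))

-- t is a (possible) run of Spuler's algorithm on instance (n,p), for any
-- resolution of ties.
SpulerRun : ℕ → (ℕ → ℕ) → (ℕ → ℕ → ℕ → Tree) → Set
SpulerRun n p t =
  (∀ i j h → 1 ≤ i → j ≤ n → h + i ≡ j →
     ∃ λ a → i ≤ a × a ≤ j × t i j h ≡ leaf a)
  ×
  (∀ i j h → 1 ≤ i → j ≤ n → h + i < j →
     IsCandidate p t i j h (t i j h) ×
     (∀ T → IsCandidate p t i j h T → cost p (t i j h) ≤ cost p T))

-- The query set [i,j] \ H is
-- represented as a sublist Q of the interval list with |Q| + h = |[i,j]|.
NotOptimal : ℕ → (ℕ → ℕ) → ℕ → ℕ → ℕ → Tree → Set
NotOptimal n p i j h T₀ =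
  ∃ λ Q → ∃ λ T →
    Q ⊆ interval i j × length Q + h ≡ suc j ∸ i ×
    CorrectFor n T Q × cost p T < cost p T₀

-- Every candidate of Spuler's recurrence puts cheapest trees of smaller subproblems one level lower, which
-- adds their weight to their cost.  Once keys may be left out (h > 0) that weight is no longer fixed by the
-- subproblem, so a costlier but lighter subtree can give a cheaper tree; for the nine weights below this
-- happens at ([1,9], 1).  To cover every resolution of ties we follow all runs at once.  By induction on the
-- number of queries, a run is either suboptimal somewhere or, at each subproblem, its tree has the cost and
-- the leaves of a "reachable" tree: a cheapest candidate built from reachable subtrees.  Candidates built from
-- correct trees are correct, so if the run's tree is not among the cheapest such candidates, a cheaper one
-- witnesses suboptimality.  At ([1,9], 1) every reachable tree costs 232, while a correct tree of cost 231
-- exists.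
module Submission where

open import Defs
open import Data.Nat using (ℕ; zero; suc; _+_; _*_; _∸_; _≤_; _<_; z≤n; s≤s; s≤s⁻¹; _≤?_; _<?_)
open import Data.Nat.Properties
open import Data.Nat.ListAction using (sum)
open import Data.Nat.ListAction.Properties using (sum-↭; sum-++)
open import Data.Nat.Tactic.RingSolver using (solve-∀)
open import Data.Bool using (true; false; T; if_then_else_)
open import Data.Unit using (tt)
open import Data.Empty using (⊥-elim)
open import Data.Product using (∃; _×_; _,_; proj₁; proj₂; uncurry)
import Data.Product.Properties as Product
open import Data.Sum using (_⊎_; inj₁; inj₂; [_,_]′)
import Data.Sum as Sum
open import Data.List
  using (List; []; _∷_; _++_; map; concat; concatMap; upTo; applyUpTo; length; filter;
         cartesianProduct; cartesianProductWith; deduplicate)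
open import Data.List.Properties using (map-++; length-++; map-cong-local)
import Data.List.Properties as List
open import Data.List.Extrema.Nat using (argmin; argmin-sel; f[argmin]≤f[xs])
open import Data.List.Sort.InsertionSort.Base ≤-decTotalOrder using (sort)
open import Data.List.Sort.InsertionSort.Properties ≤-decTotalOrder using (sort-↭)
open import Data.List.Membership.Propositional using (_∈_; _∉_; find; lose)
open import Data.List.Membership.Propositional.Properties
  using (∈-map⁺; ∈-map⁻; ∈-upTo⁺; ∈-upTo⁻; ∈-++⁺ˡ; ∈-++⁺ʳ; ∈-++⁻; ∈-filter⁺; ∈-filter⁻;
         ∈-concatMap⁺; ∈-concatMap⁻; ∈-cartesianProductWith⁺; ∈-cartesianProductWith⁻; ∈-cartesianProduct⁺)
open import Data.List.Membership.Propositional.Properties.WithK using (unique∧set⇒bag)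
open import Data.List.Membership.DecPropositional _≟_ using (_∈?_)
open import Data.List.Relation.Unary.Any using (here; there)
import Data.List.Relation.Unary.Any.Properties as Any
open import Data.List.Relation.Unary.All as All using (All; all?; []; _∷_)
import Data.List.Relation.Unary.All.Properties as All
open import Data.List.Relation.Unary.AllPairs using ([]; _∷_)
open import Data.List.Relation.Unary.Unique.Propositional using (Unique)
open import Data.List.Relation.Unary.Unique.DecPropositional _≟_ using (unique?)
import Data.List.Relation.Unary.Unique.Propositional.Properties as Unique
open import Data.List.Relation.Binary.Permutation.Propositional using (_↭_; ↭-refl; ↭-sym; ↭-trans)
open import Data.List.Relation.Binary.Permutation.Propositional.Properties using (∈-resp-↭; ++⁺)
import Data.List.Relation.Binary.Permutation.Propositional.Properties as Perm
open import Data.List.Relation.Binary.BagAndSetEquality using (∼bag⇒↭)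
open import Data.List.Relation.Binary.Sublist.Propositional.Properties using (filter-⊆)
open import Function using (id; _∘_; mk⇔)
open import Relation.Nullary using (Dec; yes; no; ¬_; ¬?; _×-dec_; _⊎-dec_)
open import Relation.Nullary.Decidable using (map′; from-yes)
open import Relation.Unary using (Decidable)
open import Relation.Binary.PropositionalEquality
  using (_≡_; _≢_; refl; sym; trans; cong; cong₂; subst; module ≡-Reasoning)

-- Costs and weights of trees

module _ (p : ℕ → ℕ) where

  weight : Tree → ℕ
  weight T = sum (map p (leaves T))

  sum-map-↭ : ∀ {xs ys} → xs ↭ ys → sum (map p xs) ≡ sum (map p ys)
  sum-map-↭ π = sum-↭ (Perm.map⁺ p π)

  sum-map-++ : ∀ xs ys → sum (map p (xs ++ ys)) ≡ sum (map p xs) + sum (map p ys)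
  sum-map-++ xs ys = trans (cong sum (map-++ p xs ys)) (sum-++ (map p xs) (map p ys))

  costAt-suc : ∀ d T → costAt p (suc d) T ≡ costAt p d T + weight T

  costAt-suc-node : ∀ d y n → costAt p (suc (suc d)) y + costAt p (suc (suc d)) n
                            ≡ (costAt p (suc d) y + costAt p (suc d) n) + sum (map p (leaves y ++ leaves n))
  costAt-suc-node d y n = begin
    costAt p (suc (suc d)) y + costAt p (suc (suc d)) n
      ≡⟨ cong₂ _+_ (costAt-suc (suc d) y) (costAt-suc (suc d) n) ⟩
    (costAt p (suc d) y + weight y) + (costAt p (suc d) n + weight n)
      ≡⟨ interchange (costAt p (suc d) y) (weight y) (costAt p (suc d) n) (weight n) ⟩
    (costAt p (suc d) y + costAt p (suc d) n) + (weight y + weight n)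
      ≡⟨ cong (costAt p (suc d) y + costAt p (suc d) n +_) (sym (sum-map-++ (leaves y) (leaves n))) ⟩
    (costAt p (suc d) y + costAt p (suc d) n) + sum (map p (leaves y ++ leaves n)) ∎
    where
    open ≡-Reasoning
    interchange : ∀ a b c e → (a + b) + (c + e) ≡ (a + c) + (b + e)
    interchange = solve-∀

  costAt-suc d (leaf a)    = shift (p a) (d * p a)
    where
    shift : ∀ x y → x + y ≡ y + (x + 0)
    shift = solve-∀
  costAt-suc d (eqN k y n) = costAt-suc-node d y n
  costAt-suc d (ltN k y n) = costAt-suc-node d y n

  cost-eqN : ∀ k y n → cost p (eqN k y n) ≡ (cost p y + weight y) + (cost p n + weight n)
  cost-eqN k y n = cong₂ _+_ (costAt-suc 0 y) (costAt-suc 0 n)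

  cost-ltN : ∀ k y n → cost p (ltN k y n) ≡ (cost p y + weight y) + (cost p n + weight n)
  cost-ltN k y n = cong₂ _+_ (costAt-suc 0 y) (costAt-suc 0 n)

  record SameCostAndLeaves (T U : Tree) : Set where
    constructor same
    field
      same-cost   : cost p T ≡ cost p U
      same-leaves : leaves T ↭ leaves U

  private
    subtrees-cong : ∀ {y y′ n n′} → SameCostAndLeaves y y′ → SameCostAndLeaves n n′ →
                    (cost p y + weight y) + (cost p n + weight n) ≡ (cost p y′ + weight y′) + (cost p n′ + weight n′)
    subtrees-cong (same cy πy) (same cn πn) =
      cong₂ _+_ (cong₂ _+_ cy (sum-map-↭ πy)) (cong₂ _+_ cn (sum-map-↭ πn))

  eqN-cong : ∀ k {y y′ n n′} → SameCostAndLeaves y y′ → SameCostAndLeaves n n′ →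
             SameCostAndLeaves (eqN k y n) (eqN k y′ n′)
  eqN-cong k {y} {y′} {n} {n′} sy@(same _ πy) sn@(same _ πn) =
    same (trans (cost-eqN k y n) (trans (subtrees-cong sy sn) (sym (cost-eqN k y′ n′)))) (++⁺ πy πn)

  ltN-cong : ∀ k {y y′ n n′} → SameCostAndLeaves y y′ → SameCostAndLeaves n n′ →
             SameCostAndLeaves (ltN k y n) (ltN k y′ n′)
  ltN-cong k {y} {y′} {n} {n′} sy@(same _ πy) sn@(same _ πn) =
    same (trans (cost-ltN k y n) (trans (subtrees-cong sy sn) (sym (cost-ltN k y′ n′)))) (++⁺ πy πn)

same-refl : ∀ {p T} → SameCostAndLeaves p T T
same-refl = same refl ↭-refl

same-trans : ∀ {p T U V} → SameCostAndLeaves p T U → SameCostAndLeaves p U V → SameCostAndLeaves p T V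
same-trans (same c π) (same c′ π′) = same (trans c c′) (↭-trans π π′)

if-T : ∀ {b} {A : Set} {x y : A} → T b → (if b then x else y) ≡ x
if-T {true} _ = refl

if-¬T : ∀ {b} {A : Set} {x y : A} → ¬ T b → (if b then x else y) ≡ y
if-¬T {true}  ¬t = ⊥-elim (¬t tt)
if-¬T {false} _  = refl

search-eqN-here : ∀ k y n → search (eqN k y n) k ≡ search y k
search-eqN-here k y n = if-T (≡⇒≡ᵇ k k refl)

search-eqN-there : ∀ {v k} y n → v ≢ k → search (eqN k y n) v ≡ search n v
search-eqN-there {v} {k} y n v≢k = if-¬T (v≢k ∘ ≡ᵇ⇒≡ v k)

search-ltN-left : ∀ {v k} y n → v < k → search (ltN k y n) v ≡ search y v
search-ltN-left y n v<k = if-T (<⇒<ᵇ v<k)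

search-ltN-right : ∀ {v k} y n → k ≤ v → search (ltN k y n) v ≡ search n v
search-ltN-right {v} {k} y n k≤v = if-¬T (λ v<ᵇk → <⇒≱ (<ᵇ⇒< v k v<ᵇk) k≤v)

∈-interval⁺ : ∀ {i j x} → i ≤ x → x ≤ j → x ∈ interval i j
∈-interval⁺ {i} {j} {x} i≤x x≤j =
  subst (_∈ interval i j) (m+[n∸m]≡n i≤x) (∈-map⁺ (i +_) (∈-upTo⁺ x∸i<))
  where
  x∸i< : x ∸ i < suc j ∸ i
  x∸i< = m+n≤o⇒m≤o∸n (suc (x ∸ i)) (subst (_≤ suc j) (sym (cong suc (m∸n+n≡m i≤x))) (s≤s x≤j))

∈-interval⁻ : ∀ {i j x} → x ∈ interval i j → i ≤ x × x ≤ j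
∈-interval⁻ {i} {j} x∈ with ∈-map⁻ (i +_) x∈
... | k , k∈ , refl = m≤m+n i k , s≤s⁻¹ (subst (i + k <_) (m+[n∸m]≡n (<⇒≤ i<1+j)) (+-monoʳ-< i k<))
  where
  k< : k < suc j ∸ i
  k< = ∈-upTo⁻ k∈
  i<1+j : i < suc j
  i<1+j = m∸n≢0⇒n<m (λ eq → n≮0 (subst (k <_) eq k<))

interval-unique : ∀ i j → Unique (interval i j)
interval-unique i j = Unique.map⁺ (+-cancelˡ-≡ i _ _) (Unique.upTo⁺ (suc j ∸ i))

∸-+-∸ : ∀ {i s k} → i ≤ s → s ≤ k → (s ∸ i) + (k ∸ s) ≡ k ∸ i
∸-+-∸ {i} {s} {k} i≤s s≤k = begin
  (s ∸ i) + (k ∸ s) ≡⟨ +-comm (s ∸ i) (k ∸ s) ⟩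
  (k ∸ s) + (s ∸ i) ≡⟨ +-∸-assoc (k ∸ s) i≤s ⟨
  (k ∸ s + s) ∸ i   ≡⟨ cong (_∸ i) (m∸n+n≡m s≤k) ⟩
  k ∸ i             ∎
  where open ≡-Reasoning

-- Correct trees for a subproblem

-- T is a correct search tree for [i,j] ∖ H for some H ⊆ [i,j] with |H| = h.
record Feasible (n i j h : ℕ) (T : Tree) : Set where
  constructor feasible
  field
    keys-in-K       : All (InK n) (nodeKeys T)
    leaves-distinct : Unique (leaves T)
    leaves-in-I     : All (λ v → i ≤ v × v ≤ j) (leaves T)
    leaf-count      : length (leaves T) + h ≡ suc j ∸ i
    search-correct  : All (λ v → search T v ≡ v) (leaves T)

open Feasible

feasible? : ∀ n i j h T → Dec (Feasible n i j h T)
feasible? n i j h T =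
  map′ (λ (a , b , c , d , e) → feasible a b c d e) (λ (feasible a b c d e) → a , b , c , d , e)
       (all? (λ k → 1 ≤? k ×-dec k ≤? n) (nodeKeys T) ×-dec unique? (leaves T) ×-dec
        all? (λ v → i ≤? v ×-dec v ≤? j) (leaves T) ×-dec length (leaves T) + h ≟ suc j ∸ i ×-dec
        all? (λ v → search T v ≟ v) (leaves T))

cheaper-feasible⇒NotOptimal : ∀ {n p i j h T T₀} → Feasible n i j h T → cost p T < cost p T₀ →
                              NotOptimal n p i j h T₀
cheaper-feasible⇒NotOptimal {n} {p} {i} {j} {h} {T} F cheaper =
  Q , T , filter-⊆ (_∈? leaves T) (interval i j) , count ,
  (keys-in-K F , π , λ v v∈Q → All.lookup (search-correct F) (∈-resp-↭ (↭-sym π) v∈Q)) , cheaper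
  where
  Q : List ℕ
  Q = filter (_∈? leaves T) (interval i j)
  π : leaves T ↭ Q
  π = ∼bag⇒↭ (unique∧set⇒bag (leaves-distinct F) (Unique.filter⁺ (_∈? leaves T) (interval-unique i j))
                             (mk⇔ to from))
    where
    to : ∀ {v} → v ∈ leaves T → v ∈ Q
    to v∈T = ∈-filter⁺ (_∈? leaves T) (uncurry ∈-interval⁺ (All.lookup (leaves-in-I F) v∈T)) v∈T
    from : ∀ {v} → v ∈ Q → v ∈ leaves T
    from v∈Q = proj₂ (∈-filter⁻ (_∈? leaves T) {xs = interval i j} v∈Q)
  count : length Q + h ≡ suc j ∸ i
  count = trans (cong (_+ h) (sym (Perm.↭-length π))) (leaf-count F)

leaf-feasible : ∀ {n i j h a} → i ≤ a → a ≤ j → h + i ≡ j → Feasible n i j h (leaf a)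
leaf-feasible {i = i} {h = h} i≤a a≤j refl = record
  { keys-in-K       = []
  ; leaves-distinct = [] ∷ []
  ; leaves-in-I     = (i≤a , a≤j) ∷ []
  ; leaf-count      = sym (m+n∸n≡m (suc h) i)
  ; search-correct  = refl ∷ []
  }

eqN-feasible : ∀ {n i j h e U} → 1 ≤ i → j ≤ n → i ≤ e → e ≤ j → e ∉ leaves U →
               Feasible n i j (suc h) U → Feasible n i j h (eqN e (leaf e) U)
eqN-feasible {h = h} {e} {U} 1≤i j≤n i≤e e≤j e∉U F = record
  { keys-in-K       = (≤-trans 1≤i i≤e , ≤-trans e≤j j≤n) ∷ keys-in-K F
  ; leaves-distinct = All.tabulate (λ v∈U e≡v → e∉U (subst (_∈ leaves U) (sym e≡v) v∈U)) ∷ leaves-distinct F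
  ; leaves-in-I     = (i≤e , e≤j) ∷ leaves-in-I F
  ; leaf-count      = trans (sym (+-suc (length (leaves U)) h)) (leaf-count F)
  ; search-correct  = search-eqN-here e (leaf e) U ∷ All.tabulate searchU
  }
  where
  searchU : ∀ {v} → v ∈ leaves U → search (eqN e (leaf e) U) v ≡ v
  searchU v∈U = trans (search-eqN-there (leaf e) U (λ v≡e → e∉U (subst (_∈ leaves U) v≡e v∈U)))
                      (All.lookup (search-correct F) v∈U)

ltN-feasible : ∀ {n i j h₁ h₂ s L R} → 1 ≤ i → j ≤ n → suc (i + h₁) ≤ s → h₂ + s ≤ j →
               Feasible n i (s ∸ 1) h₁ L → Feasible n s j h₂ R → Feasible n i j (h₁ + h₂) (ltN s L R)
ltN-feasible {n} {i} {j} {h₁} {h₂} {suc s} {L} {R} 1≤i j≤n (s≤s i+h₁≤s) h₂+s≤j FL FR = record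
  { keys-in-K       = (s≤s z≤n , ≤-trans s<j j≤n) ∷ All.++⁺ (keys-in-K FL) (keys-in-K FR)
  ; leaves-distinct = Unique.++⁺ (leaves-distinct FL) (leaves-distinct FR) disjoint
  ; leaves-in-I     = All.++⁺ (All.map (λ (i≤v , v≤s) → i≤v , ≤-trans v≤s (<⇒≤ s<j)) (leaves-in-I FL))
                              (All.map (λ (s≤v , v≤j) → ≤-trans i≤s s≤v , v≤j) (leaves-in-I FR))
  ; leaf-count      = count
  ; search-correct  = All.++⁺ (All.tabulate searchL) (All.tabulate searchR)
  }
  where
  s<j : s < j
  s<j = m+n≤o⇒n≤o h₂ h₂+s≤j
  i≤s : i ≤ suc s
  i≤s = m≤n⇒m≤1+n (m+n≤o⇒m≤o i i+h₁≤s)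
  below : ∀ {v} → v ∈ leaves L → v < suc s
  below v∈L = s≤s (proj₂ (All.lookup (leaves-in-I FL) v∈L))
  above : ∀ {v} → v ∈ leaves R → suc s ≤ v
  above v∈R = proj₁ (All.lookup (leaves-in-I FR) v∈R)
  disjoint : ∀ {v} → ¬ (v ∈ leaves L × v ∈ leaves R)
  disjoint (v∈L , v∈R) = <⇒≱ (below v∈L) (above v∈R)
  searchL : ∀ {v} → v ∈ leaves L → search (ltN (suc s) L R) v ≡ v
  searchL v∈L = trans (search-ltN-left L R (below v∈L)) (All.lookup (search-correct FL) v∈L)
  searchR : ∀ {v} → v ∈ leaves R → search (ltN (suc s) L R) v ≡ v
  searchR v∈R = trans (search-ltN-right L R (above v∈R)) (All.lookup (search-correct FR) v∈R)
  count : length (leaves L ++ leaves R) + (h₁ + h₂) ≡ suc j ∸ i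
  count = begin
    length (leaves L ++ leaves R) + (h₁ + h₂)
      ≡⟨ cong (_+ (h₁ + h₂)) (length-++ (leaves L)) ⟩
    (length (leaves L) + length (leaves R)) + (h₁ + h₂)
      ≡⟨ interchange (length (leaves L)) (length (leaves R)) h₁ h₂ ⟩
    (length (leaves L) + h₁) + (length (leaves R) + h₂)
      ≡⟨ cong₂ _+_ (leaf-count FL) (leaf-count FR) ⟩
    (suc s ∸ i) + (suc j ∸ suc s)
      ≡⟨ ∸-+-∸ i≤s (m≤n⇒m≤1+n s<j) ⟩
    suc j ∸ i ∎
    where
    open ≡-Reasoning
    interchange : ∀ a b c d → (a + b) + (c + d) ≡ (a + c) + (b + d)
    interchange = solve-∀

-- Spuler's candidates

LeastNonLeaf-resp-↭ : ∀ {p i j T U e} → leaves T ↭ leaves U → LeastNonLeaf p i j T e → LeastNonLeaf p i j U e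
LeastNonLeaf-resp-↭ π (i≤e , e≤j , e∉T , least) =
  i≤e , e≤j , (λ e∈U → e∉T (∈-resp-↭ (↭-sym π) e∈U)) ,
  (λ e′ i≤e′ e′≤j e′∉U → least e′ i≤e′ e′≤j (λ e′∈T → e′∉U (∈-resp-↭ π e′∈T)))

leastNonLeaf? : ∀ p i j T → Decidable (LeastNonLeaf p i j T)
leastNonLeaf? p i j T e =
  i ≤? e ×-dec e ≤? j ×-dec ¬? (e ∈? leaves T) ×-dec
  map′ fromAll toAll (all? (λ e′ → e′ ∈? leaves T ⊎-dec p e ≤? p e′) (interval i j))
  where
  fromAll : All (λ e′ → e′ ∈ leaves T ⊎ p e ≤ p e′) (interval i j) →
            ∀ e′ → i ≤ e′ → e′ ≤ j → e′ ∉ leaves T → p e ≤ p e′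
  fromAll all e′ i≤e′ e′≤j e′∉T with All.lookup all (∈-interval⁺ i≤e′ e′≤j)
  ... | inj₁ e′∈T   = ⊥-elim (e′∉T e′∈T)
  ... | inj₂ pe≤pe′ = pe≤pe′
  toAll : (∀ e′ → i ≤ e′ → e′ ≤ j → e′ ∉ leaves T → p e ≤ p e′) →
          All (λ e′ → e′ ∈ leaves T ⊎ p e ≤ p e′) (interval i j)
  toAll least = All.tabulate λ {e′} e′∈I → leafOrHeavier e′ (∈-interval⁻ e′∈I)
    where
    leafOrHeavier : ∀ e′ → i ≤ e′ × e′ ≤ j → e′ ∈ leaves T ⊎ p e ≤ p e′
    leafOrHeavier e′ (i≤e′ , e′≤j) with e′ ∈? leaves T
    ... | yes e′∈T = inj₁ e′∈T
    ... | no e′∉T  = inj₂ (least e′ i≤e′ e′≤j e′∉T)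

-- The split (s , h₁) of ([i,j], h) leaves out h₁ keys of [i,s-1] and h ∸ h₁ keys of [s,j].
record Split (i j h s h₁ : ℕ) : Set where
  constructor split
  field
    part-bound     : h₁ ≤ h
    left-nonempty  : suc (i + h₁) ≤ s
    right-nonempty : (h ∸ h₁) + s ≤ j

split? : ∀ i j h s h₁ → Dec (Split i j h s h₁)
split? i j h s h₁ = map′ (λ (a , b , c) → split a b c) (λ (split a b c) → a , b , c)
                         (h₁ ≤? h ×-dec suc (i + h₁) ≤? s ×-dec (h ∸ h₁) + s ≤? j)

splits : ℕ → ℕ → ℕ → List (ℕ × ℕ)
splits i j h = filter (uncurry (split? i j h)) (cartesianProduct (interval (suc i) j) (upTo (suc h)))

∈-splits⁺ : ∀ {i j h s h₁} → Split i j h s h₁ → (s , h₁) ∈ splits i j h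
∈-splits⁺ {i} {j} {h} {s} {h₁} σ@(split h₁≤h i+h₁<s h₂+s≤j) =
  ∈-filter⁺ (uncurry (split? i j h)) (∈-cartesianProduct⁺ s∈ (∈-upTo⁺ (s≤s h₁≤h))) σ
  where
  s∈ : s ∈ interval (suc i) j
  s∈ = ∈-interval⁺ (≤-trans (s≤s (m≤m+n i h₁)) i+h₁<s) (m+n≤o⇒n≤o (h ∸ h₁) h₂+s≤j)

∈-splits⁻ : ∀ {i j h s h₁} → (s , h₁) ∈ splits i j h → Split i j h s h₁
∈-splits⁻ {i} {j} {h} x∈ =
  proj₂ (∈-filter⁻ (uncurry (split? i j h)) {xs = cartesianProduct (interval (suc i) j) (upTo (suc h))} x∈)

Family : Set
Family = ℕ → ℕ → ℕ → List Tree

equalityExtensions : (ℕ → ℕ) → ℕ → ℕ → Tree → List Tree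
equalityExtensions p i j U = map (λ e → eqN e (leaf e) U) (filter (leastNonLeaf? p i j U) (interval i j))

splitTrees : Family → ℕ → ℕ → ℕ → ℕ × ℕ → List Tree
splitTrees S i j h (s , h₁) = cartesianProductWith (ltN s) (S i (s ∸ 1) h₁) (S s j (h ∸ h₁))

candidates : (ℕ → ℕ) → Family → ℕ → ℕ → ℕ → List Tree
candidates p S i j h =
  concatMap (equalityExtensions p i j) (S i j (suc h)) ++ concatMap (splitTrees S i j h) (splits i j h)

data Candidate (p : ℕ → ℕ) (S : Family) (i j : ℕ) : ℕ → Tree → Set where
  equality : ∀ {h e U} → U ∈ S i j (suc h) → LeastNonLeaf p i j U e → Candidate p S i j h (eqN e (leaf e) U)
  lessThan : ∀ {h₁ h₂ s L R} → suc (i + h₁) ≤ s → h₂ + s ≤ j →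
             L ∈ S i (s ∸ 1) h₁ → R ∈ S s j h₂ → Candidate p S i j (h₁ + h₂) (ltN s L R)

∈-candidates⁺ : ∀ {p S i j h T} → Candidate p S i j h T → T ∈ candidates p S i j h
∈-candidates⁺ {p} {i = i} {j} (equality {U = U} U∈S least@(i≤e , e≤j , _)) =
  ∈-++⁺ˡ (∈-concatMap⁺ (equalityExtensions p i j)
           (lose U∈S (∈-map⁺ _ (∈-filter⁺ (leastNonLeaf? p i j U) (∈-interval⁺ i≤e e≤j) least))))
∈-candidates⁺ {p} {S} {i} {j} (lessThan {h₁} {h₂} {s} {L} {R} i+h₁<s h₂+s≤j L∈S R∈S) =
  ∈-++⁺ʳ _ (∈-concatMap⁺ (splitTrees S i j (h₁ + h₂)) (lose (∈-splits⁺ σ) LR∈))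
  where
  h₂≡ : h₁ + h₂ ∸ h₁ ≡ h₂
  h₂≡ = m+n∸m≡n h₁ h₂
  σ : Split i j (h₁ + h₂) s h₁
  σ = split (m≤m+n h₁ h₂) i+h₁<s (subst (λ h → h + s ≤ j) (sym h₂≡) h₂+s≤j)
  LR∈ : ltN s L R ∈ splitTrees S i j (h₁ + h₂) (s , h₁)
  LR∈ = subst (λ h → ltN s L R ∈ cartesianProductWith (ltN s) (S i (s ∸ 1) h₁) (S s j h)) (sym h₂≡)
              (∈-cartesianProductWith⁺ (ltN s) L∈S R∈S)

∈-candidates⁻ : ∀ {p S i j h T} → T ∈ candidates p S i j h → Candidate p S i j h T
∈-candidates⁻ {p} {S} {i} {j} {h} T∈ with ∈-++⁻ (concatMap (equalityExtensions p i j) (S i j (suc h))) T∈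
... | inj₁ T∈eq with find (∈-concatMap⁻ (equalityExtensions p i j) {xs = S i j (suc h)} T∈eq)
...   | U , U∈S , T∈ext with ∈-map⁻ (λ e → eqN e (leaf e) U) T∈ext
...     | e , e∈ , refl = equality U∈S (proj₂ (∈-filter⁻ (leastNonLeaf? p i j U) {xs = interval i j} e∈))
∈-candidates⁻ {p} {S} {i} {j} {h} T∈ | inj₂ T∈lt
  with find (∈-concatMap⁻ (splitTrees S i j h) {xs = splits i j h} T∈lt)
... | (s , h₁) , x∈ , T∈split with ∈-cartesianProductWith⁻ (ltN s) (S i (s ∸ 1) h₁) (S s j (h ∸ h₁)) T∈split
...   | L , R , L∈ , R∈ , refl with ∈-splits⁻ x∈
...     | split h₁≤h i+h₁<s h₂+s≤j =
  subst (λ h′ → Candidate p S i j h′ (ltN s L R)) (m+[n∸m]≡n h₁≤h) (lessThan i+h₁<s h₂+s≤j L∈ R∈)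

candidates-cong : ∀ {p S S′ i j h} → S i j (suc h) ≡ S′ i j (suc h) →
                  (∀ {s h₁ h₂} → h₁ + h₂ ≡ h → suc (i + h₁) ≤ s → h₂ + s ≤ j →
                     S i (s ∸ 1) h₁ ≡ S′ i (s ∸ 1) h₁ × S s j h₂ ≡ S′ s j h₂) →
                  candidates p S i j h ≡ candidates p S′ i j h
candidates-cong {p} {S} {S′} {i} {j} {h} eq split-eq =
  cong₂ _++_ (cong (concatMap (equalityExtensions p i j)) eq)
             (cong concat (map-cong-local (All.tabulate (λ {x} x∈ → splitTrees-cong x x∈))))
  where
  splitTrees-cong : ∀ x → x ∈ splits i j h → splitTrees S i j h x ≡ splitTrees S′ i j h x
  splitTrees-cong (s , h₁) x∈ with split h₁≤h i+h₁<s h₂+s≤j ← ∈-splits⁻ x∈ =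
    cong₂ (cartesianProductWith (ltN s)) (proj₁ agree) (proj₂ agree)
    where agree = split-eq (m+[n∸m]≡n h₁≤h) i+h₁<s h₂+s≤j

FeasibleFamily : ℕ → Family → Set
FeasibleFamily n S = ∀ {i j h U} → 1 ≤ i → j ≤ n → h + i ≤ j → U ∈ S i j h → Feasible n i j h U

candidate-feasible : ∀ {n p S i j h T} → FeasibleFamily n S → 1 ≤ i → j ≤ n → h + i < j →
                     Candidate p S i j h T → Feasible n i j h T
candidate-feasible FS 1≤i j≤n h+i<j (equality U∈S (i≤e , e≤j , e∉U , _)) =
  eqN-feasible 1≤i j≤n i≤e e≤j e∉U (FS 1≤i j≤n h+i<j U∈S)
candidate-feasible {i = i} FS 1≤i j≤n _ (lessThan {h₁} {h₂} {suc s} (s≤s i+h₁≤s) h₂+s≤j L∈S R∈S) =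
  ltN-feasible 1≤i j≤n (s≤s i+h₁≤s) h₂+s≤j
    (FS 1≤i (≤-trans (<⇒≤ (m+n≤o⇒n≤o h₂ h₂+s≤j)) j≤n) (subst (_≤ s) (+-comm i h₁) i+h₁≤s) L∈S)
    (FS (s≤s z≤n) j≤n h₂+s≤j R∈S)

-- ([i,j], h) has at most k queries: |[i,j]| − h ≤ k.
record AtMost (k i j h : ℕ) : Set where
  constructor atMost
  field bound : j < h + i + k

subproblem-atMost : ∀ {n i j h} → 1 ≤ i → j ≤ n → AtMost n i j h
subproblem-atMost {n} {i} {j} {h} 1≤i j≤n = atMost (≤-<-trans j≤n (m<n+m n (≤-trans 1≤i (m≤n+m i h))))

atMost-suc : ∀ {k i j h} → AtMost k i j h → AtMost (suc k) i j h
atMost-suc {k} {i} {j} {h} (atMost j<) = atMost (<-≤-trans j< (+-monoʳ-≤ (h + i) (n≤1+n k)))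

atMost-equality : ∀ {k i j h} → AtMost (suc k) i j h → AtMost k i j (suc h)
atMost-equality {k} {i} {j} {h} (atMost j<) = atMost (subst (j <_) (+-suc (h + i) k) j<)

atMost-left : ∀ {k i j h s h₁ h₂} → h₁ + h₂ ≡ h → suc (i + h₁) ≤ s → h₂ + s ≤ j →
              AtMost (suc k) i j h → AtMost k i (s ∸ 1) h₁
atMost-left {k} {i} {j} {s = suc s} {h₁} {h₂} refl _ h₂+s≤j (atMost j<) = atMost
  (s≤s⁻¹ (+-cancelˡ-< h₂ (suc s) (suc (h₁ + i + k))
                      (subst (h₂ + suc s <_) (regroup h₁ h₂ i k) (≤-<-trans h₂+s≤j j<))))
  where
  regroup : ∀ a b c d → (a + b) + c + suc d ≡ b + suc (a + c + d)
  regroup = solve-∀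

atMost-right : ∀ {k i j h s h₁ h₂} → h₁ + h₂ ≡ h → suc (i + h₁) ≤ s →
               AtMost (suc k) i j h → AtMost k s j h₂
atMost-right {k} {i} {j} {s = s} {h₁} {h₂} refl i+h₁<s (atMost j<) = atMost
  (<-≤-trans (subst (j <_) (regroup h₁ h₂ i k) j<) (+-monoˡ-≤ k (+-monoʳ-≤ h₂ i+h₁<s)))
  where
  regroup : ∀ a b c d → (a + b) + c + suc d ≡ b + suc (c + a) + d
  regroup = solve-∀

-- Runs of Spuler's algorithm exist

singletons : (ℕ → ℕ → ℕ → Tree) → Family
singletons t i j h = t i j h ∷ []

isCandidate⇒Candidate : ∀ {p t i j h T} → IsCandidate p t i j h T → Candidate p (singletons t) i j h T
isCandidate⇒Candidate (inj₁ (e , least , refl)) = equality (here refl) least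
isCandidate⇒Candidate (inj₂ (s , h₁ , h₂ , _ , _ , refl , i+h₁<s , h₂+s≤j , refl)) =
  lessThan i+h₁<s h₂+s≤j (here refl) (here refl)

Candidate⇒isCandidate : ∀ {p t i j h T} → Candidate p (singletons t) i j h T → IsCandidate p t i j h T
Candidate⇒isCandidate (equality (here refl) least) = inj₁ (_ , least , refl)
Candidate⇒isCandidate {i = i} (lessThan {h₁} {h₂} {s} i+h₁<s h₂+s≤j (here refl) (here refl)) =
  inj₂ (s , h₁ , h₂ , ≤-trans (m≤m+n i h₁) (<⇒≤ i+h₁<s) , m+n≤o⇒n≤o h₂ h₂+s≤j , refl ,
        i+h₁<s , h₂+s≤j , refl)

-- When h + i < j the split (i+1, 0) exists; its tree is the default of argmin below, so that the
-- minimum is always attained at a candidate.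
firstSplit : ∀ {i j h} → h + i < j → Split i j h (suc i) 0
firstSplit {i} {j} {h} h+i<j = split z≤n (s≤s (≤-reflexive (+-identityʳ i))) (subst (_≤ j) (sym (+-suc h i)) h+i<j)

spulerStep : (ℕ → ℕ) → (ℕ → ℕ → ℕ → Tree) → ℕ → ℕ → ℕ → Tree
spulerStep p t i j h with h + i <? j
... | yes _ = argmin (cost p) (ltN (suc i) (t i i 0) (t (suc i) j h)) (candidates p (singletons t) i j h)
... | no _  = leaf i

spuler : (ℕ → ℕ) → ℕ → ℕ → ℕ → ℕ → Tree
spuler p zero    i j h = leaf i
spuler p (suc k)       = spulerStep p (spuler p k)

module _ {p : ℕ → ℕ} {t : ℕ → ℕ → ℕ → Tree} {i j h : ℕ} where

  private
    default = ltN (suc i) (t i i 0) (t (suc i) j h)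

  spulerStep-leaf : ¬ (h + i < j) → spulerStep p t i j h ≡ leaf i
  spulerStep-leaf h+i≮j with h + i <? j
  ... | yes h+i<j = ⊥-elim (h+i≮j h+i<j)
  ... | no _      = refl

  spulerStep-node : h + i < j → spulerStep p t i j h ≡ argmin (cost p) default (candidates p (singletons t) i j h)
  spulerStep-node h+i<j with h + i <? j
  ... | yes _    = refl
  ... | no h+i≮j = ⊥-elim (h+i≮j h+i<j)

  spulerStep-candidate : h + i < j → IsCandidate p t i j h (spulerStep p t i j h)
  spulerStep-candidate h+i<j rewrite spulerStep-node h+i<j
    with argmin-sel (cost p) default (candidates p (singletons t) i j h)
  ... | inj₁ ≡default    = subst (IsCandidate p t i j h) (sym ≡default)
                                 (Candidate⇒isCandidate {t = t}
                                   (lessThan left-nonempty right-nonempty (here refl) (here refl)))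
    where open Split (firstSplit {i} {j} {h} h+i<j)
  ... | inj₂ ∈candidates = Candidate⇒isCandidate {p} {t} (∈-candidates⁻ ∈candidates)

  spulerStep-cheapest : h + i < j → ∀ T → IsCandidate p t i j h T → cost p (spulerStep p t i j h) ≤ cost p T
  spulerStep-cheapest h+i<j T c rewrite spulerStep-node h+i<j =
    All.lookup (f[argmin]≤f[xs] default (candidates p (singletons t) i j h))
               (∈-candidates⁺ (isCandidate⇒Candidate {p} {t} c))

spuler-stable : ∀ p k {i j h} → AtMost k i j h → spuler p (suc k) i j h ≡ spuler p k i j h
spuler-stable p zero {i} {j} {h} (atMost j<) =
  spulerStep-leaf (λ h+i<j → <-asym h+i<j (subst (j <_) (+-identityʳ (h + i)) j<))
spuler-stable p (suc k) {i} {j} {h} bound = by-cases (h + i <? j)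
  where
  stable : ∀ {i′ j′ h′} → AtMost k i′ j′ h′ → spuler p (suc k) i′ j′ h′ ∷ [] ≡ spuler p k i′ j′ h′ ∷ []
  stable = cong (_∷ []) ∘ spuler-stable p k
  by-cases : Dec (h + i < j) → spulerStep p (spuler p (suc k)) i j h ≡ spulerStep p (spuler p k) i j h
  by-cases (no h+i≮j)  = trans (spulerStep-leaf h+i≮j) (sym (spulerStep-leaf h+i≮j))
  by-cases (yes h+i<j) = begin
    spulerStep p (spuler p (suc k)) i j h
      ≡⟨ spulerStep-node h+i<j ⟩
    argmin (cost p) (ltN (suc i) (spuler p (suc k) i i 0) (spuler p (suc k) (suc i) j h))
                    (candidates p (singletons (spuler p (suc k))) i j h)
      ≡⟨ cong₂ (argmin (cost p))
               (cong₂ (ltN (suc i)) (spuler-stable p k (atMost-left refl left-nonempty right-nonempty bound))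
                                    (spuler-stable p k (atMost-right refl left-nonempty bound)))
               (candidates-cong {p} {singletons (spuler p (suc k))} {singletons (spuler p k)}
                                (stable (atMost-equality bound))
                                (λ h₁+h₂≡h i+h₁<s h₂+s≤j → stable (atMost-left h₁+h₂≡h i+h₁<s h₂+s≤j bound) ,
                                                            stable (atMost-right h₁+h₂≡h i+h₁<s bound))) ⟩
    argmin (cost p) (ltN (suc i) (spuler p k i i 0) (spuler p k (suc i) j h))
                    (candidates p (singletons (spuler p k)) i j h)
      ≡⟨ spulerStep-node h+i<j ⟨
    spulerStep p (spuler p k) i j h ∎
    where
    open ≡-Reasoning
    open Split (firstSplit {i} {j} {h} h+i<j)

spuler-run : ∀ n p → SpulerRun n p (spuler p (suc n))
spuler-run n p = leaf-case , node-case
  where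
  t = spuler p (suc n)
  fixpoint : ∀ {i j h} → 1 ≤ i → j ≤ n → t i j h ≡ spulerStep p t i j h
  fixpoint 1≤i j≤n = sym (spuler-stable p (suc n) (atMost-suc (subproblem-atMost 1≤i j≤n)))
  leaf-case : ∀ i j h → 1 ≤ i → j ≤ n → h + i ≡ j → ∃ λ a → i ≤ a × a ≤ j × t i j h ≡ leaf a
  leaf-case i j h 1≤i j≤n h+i≡j =
    i , ≤-refl , subst (i ≤_) h+i≡j (m≤n+m i h) , trans (fixpoint 1≤i j≤n) (spulerStep-leaf (<-irrefl h+i≡j))
  node-case : ∀ i j h → 1 ≤ i → j ≤ n → h + i < j →
              IsCandidate p t i j h (t i j h) × (∀ T → IsCandidate p t i j h T → cost p (t i j h) ≤ cost p T)
  node-case i j h 1≤i j≤n h+i<j =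
    subst (IsCandidate p t i j h) (sym (fixpoint 1≤i j≤n)) (spulerStep-candidate h+i<j) ,
    λ T c → subst (λ U → cost p U ≤ cost p T) (sym (fixpoint 1≤i j≤n)) (spulerStep-cheapest h+i<j T c)

-- Reachable trees

cheapest : (ℕ → ℕ) → List Tree → List Tree
cheapest p []       = []
cheapest p (T ∷ Ts) = withCostAtMost (cost p (argmin (cost p) T Ts)) (T ∷ Ts)
  where withCostAtMost = λ c → filter (λ U → cost p U ≤? c)

∈-cheapest⁻ : ∀ {p T Ts} → T ∈ cheapest p Ts → T ∈ Ts
∈-cheapest⁻ {p} {Ts = U ∷ Us} T∈ =
  proj₁ (∈-filter⁻ (λ V → cost p V ≤? cost p (argmin (cost p) U Us)) {xs = U ∷ Us} T∈)

cheapest-dichotomy : ∀ {p T Ts} → T ∈ Ts → T ∈ cheapest p Ts ⊎ ∃ λ M → M ∈ cheapest p Ts × cost p M < cost p T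
cheapest-dichotomy {p} {T} {U ∷ Us} T∈ = compare (cost p T ≤? cost p m)
  where
  m = argmin (cost p) U Us
  m∈ : m ∈ U ∷ Us
  m∈ with argmin-sel (cost p) U Us
  ... | inj₁ m≡U  = here m≡U
  ... | inj₂ m∈Us = there m∈Us
  within? = λ V → cost p V ≤? cost p m
  compare : Dec (cost p T ≤ cost p m) →
            T ∈ cheapest p (U ∷ Us) ⊎ ∃ λ M → M ∈ cheapest p (U ∷ Us) × cost p M < cost p T
  compare (yes T≤m) = inj₁ (∈-filter⁺ within? T∈ T≤m)
  compare (no T≰m)  = inj₂ (m , ∈-filter⁺ within? m∈ ≤-refl , ≰⇒> T≰m)

outcome : (ℕ → ℕ) → Tree → ℕ × List ℕ
outcome p T = cost p T , sort (leaves T)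

sameOutcome? : ∀ p T U → Dec (outcome p T ≡ outcome p U)
sameOutcome? p T U = Product.≡-dec _≟_ (List.≡-dec _≟_) (outcome p T) (outcome p U)

distinctOutcomes : (ℕ → ℕ) → List Tree → List Tree
distinctOutcomes p = deduplicate (sameOutcome? p)

distinctOutcomes-covers : ∀ {p T Ts} → T ∈ Ts → ∃ λ U → U ∈ distinctOutcomes p Ts × SameCostAndLeaves p T U
distinctOutcomes-covers {p} {T} T∈ = find (Any.deduplicate⁺ (sameOutcome? p) resp (lose T∈ same-refl))
  where
  resp : ∀ {U V} → outcome p V ≡ outcome p U → SameCostAndLeaves p T U → SameCostAndLeaves p T V
  resp {U} {V} eq (same c π) =
    same (trans c (sym (cong proj₁ eq)))
         (↭-trans π (↭-trans (↭-sym (sort-↭ (leaves U)))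
                             (subst (_↭ leaves V) (cong proj₂ eq) (sort-↭ (leaves V)))))

∈-distinctOutcomes⁻ : ∀ {p T Ts} → T ∈ distinctOutcomes p Ts → T ∈ Ts
∈-distinctOutcomes⁻ {p} {Ts = Ts} = Any.deduplicate⁻ (sameOutcome? p) {xs = Ts}

reachableStep : (ℕ → ℕ) → Family → Family
reachableStep p S i j h with h + i <? j
... | yes _ = distinctOutcomes p (cheapest p (candidates p S i j h))
... | no _  = map leaf (interval i j)

module _ {p : ℕ → ℕ} {S : Family} {i j h : ℕ} where

  reachableStep-leaf : ¬ (h + i < j) → reachableStep p S i j h ≡ map leaf (interval i j)
  reachableStep-leaf h+i≮j with h + i <? j
  ... | yes h+i<j = ⊥-elim (h+i≮j h+i<j)
  ... | no _      = refl

  reachableStep-node : h + i < j → reachableStep p S i j h ≡ distinctOutcomes p (cheapest p (candidates p S i j h))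
  reachableStep-node h+i<j with h + i <? j
  ... | yes _    = refl
  ... | no h+i≮j = ⊥-elim (h+i≮j h+i<j)

at : {A : Set} → A → List A → ℕ → A
at d []       _       = d
at d (x ∷ xs) zero    = x
at d (x ∷ xs) (suc k) = at d xs k

at-applyUpTo : ∀ {A : Set} {d : A} f {m x} → x < m → at d (applyUpTo f m) x ≡ f x
at-applyUpTo f {suc m} {zero}  _          = refl
at-applyUpTo f {suc m} {suc x} (s≤s x<m) = at-applyUpTo (f ∘ suc) x<m

-- Families stored as data, so that each entry is computed once when a table is evaluated.
Table : Set
Table = List (List (List (List Tree)))

tabulate : ℕ → Family → Table
tabulate b S = applyUpTo (λ i → applyUpTo (λ j → applyUpTo (S i j) b) b) b

lookup : Table → Family
lookup tbl i j h = at [] (at [] (at [] tbl i) j) h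

lookup-tabulate : ∀ {b} S {i j h} → i < b → j < b → h < b → lookup (tabulate b S) i j h ≡ S i j h
lookup-tabulate {b} S {i} {j} {h} i<b j<b h<b = begin
  at [] (at [] (at [] (tabulate b S) i) j) h
    ≡⟨ cong (λ row → at [] (at [] row j) h) (at-applyUpTo _ i<b) ⟩
  at [] (at [] (applyUpTo (λ j → applyUpTo (S i j) b) b) j) h
    ≡⟨ cong (λ row → at [] row h) (at-applyUpTo _ j<b) ⟩
  at [] (applyUpTo (S i j) b) h
    ≡⟨ at-applyUpTo (S i j) h<b ⟩
  S i j h ∎
  where open ≡-Reasoning

reachableTable : (ℕ → ℕ) → ℕ → ℕ → Table
reachableTable p n zero    = tabulate (suc n) (λ _ _ _ → [])
reachableTable p n (suc k) = tabulate (suc n) (reachableStep p (lookup (reachableTable p n k)))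

-- Up to cost and leaves, the trees that a run which is nowhere suboptimal can have at subproblems with at
-- most k queries.
reachable : (ℕ → ℕ) → ℕ → ℕ → Family
reachable p n k = lookup (reachableTable p n k)

module _ {n i j h : ℕ} (1≤i : 1 ≤ i) (j≤n : j ≤ n) (h+i≤j : h + i ≤ j) where

  private
    i<1+n : i < suc n
    i<1+n = s≤s (≤-trans (m≤n+m i h) (≤-trans h+i≤j j≤n))
    h<1+n : h < suc n
    h<1+n = s≤s (≤-trans (m≤m+n h i) (≤-trans h+i≤j j≤n))

  reachable-zero : ∀ {p} → reachable p n 0 i j h ≡ []
  reachable-zero = lookup-tabulate (λ _ _ _ → []) i<1+n (s≤s j≤n) h<1+n

  reachable-suc : ∀ {p} k → reachable p n (suc k) i j h ≡ reachableStep p (reachable p n k) i j h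
  reachable-suc {p} k = lookup-tabulate (reachableStep p (reachable p n k)) i<1+n (s≤s j≤n) h<1+n

reachable-feasible : ∀ p n k → FeasibleFamily n (reachable p n k)
reachable-feasible p n zero {U = U} 1≤i j≤n h+i≤j U∈
  with () ← subst (U ∈_) (reachable-zero 1≤i j≤n h+i≤j {p}) U∈
reachable-feasible p n (suc k) {i} {j} {h} {U} 1≤i j≤n h+i≤j U∈ =
  by-cases (h + i <? j) (subst (U ∈_) (reachable-suc 1≤i j≤n h+i≤j k) U∈)
  where
  by-cases : Dec (h + i < j) → U ∈ reachableStep p (reachable p n k) i j h → Feasible n i j h U
  by-cases (yes h+i<j) U∈ = candidate-feasible (reachable-feasible p n k) 1≤i j≤n h+i<j
    (∈-candidates⁻ (∈-cheapest⁻ (∈-distinctOutcomes⁻ (subst (U ∈_) (reachableStep-node h+i<j) U∈))))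
  by-cases (no h+i≮j) U∈ with ∈-map⁻ leaf (subst (U ∈_) (reachableStep-leaf h+i≮j) U∈)
  ... | a , a∈ , refl =
    leaf-feasible (proj₁ (∈-interval⁻ a∈)) (proj₂ (∈-interval⁻ a∈)) (≤-antisym h+i≤j (≮⇒≥ h+i≮j))

Suboptimal : ℕ → (ℕ → ℕ) → (ℕ → ℕ → ℕ → Tree) → Set
Suboptimal n p t = ∃ λ i → ∃ λ j → ∃ λ h → 1 ≤ i × j ≤ n × h + i ≤ j × NotOptimal n p i j h (t i j h)

Reaches : (ℕ → ℕ) → ℕ → (ℕ → ℕ → ℕ → Tree) → ℕ → ℕ → ℕ → ℕ → Set
Reaches p n t k i j h = ∃ λ U → U ∈ reachable p n k i j h × SameCostAndLeaves p (t i j h) U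

module _ {n p t} (run : SpulerRun n p t) where

  suboptimal-or-reaches : ∀ k {i j h} → 1 ≤ i → j ≤ n → h + i ≤ j → AtMost k i j h →
                          Suboptimal n p t ⊎ Reaches p n t k i j h

  candidate-reaches : ∀ k {i j h T} → 1 ≤ i → j ≤ n → h + i < j → AtMost (suc k) i j h → IsCandidate p t i j h T →
                      Suboptimal n p t ⊎ ∃ λ C → Candidate p (reachable p n k) i j h C × SameCostAndLeaves p T C
  candidate-reaches k 1≤i j≤n h+i<j bound (inj₁ (e , least , refl))
    with suboptimal-or-reaches k 1≤i j≤n h+i<j (atMost-equality bound)
  ... | inj₁ bad                             = inj₁ bad
  ... | inj₂ (U , U∈ , same-U@(same _ π)) =
    inj₂ (eqN e (leaf e) U , equality U∈ (LeastNonLeaf-resp-↭ {T = t _ _ _} {U = U} π least) ,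
          eqN-cong p e same-refl same-U)
  candidate-reaches k {i} 1≤i j≤n h+i<j bound
                    (inj₂ (suc s , h₁ , h₂ , _ , s≤j , refl , i+h₁<s@(s≤s i+h₁≤s) , h₂+s≤j , refl))
    with suboptimal-or-reaches k 1≤i (≤-trans (n≤1+n s) (≤-trans s≤j j≤n)) (subst (_≤ s) (+-comm i h₁) i+h₁≤s)
                               (atMost-left refl i+h₁<s h₂+s≤j bound)
       | suboptimal-or-reaches k (s≤s z≤n) j≤n h₂+s≤j (atMost-right refl i+h₁<s bound)
  ... | inj₁ bad | _        = inj₁ bad
  ... | inj₂ _   | inj₁ bad = inj₁ bad
  ... | inj₂ (L , L∈ , same-L) | inj₂ (R , R∈ , same-R) =
    inj₂ (ltN (suc s) L R , lessThan i+h₁<s h₂+s≤j L∈ R∈ , ltN-cong p (suc s) same-L same-R)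

  suboptimal-or-reaches zero {i} {j} {h} _ _ h+i≤j (atMost j<) =
    ⊥-elim (<⇒≱ (subst (j <_) (+-identityʳ (h + i)) j<) h+i≤j)
  suboptimal-or-reaches (suc k) {i} {j} {h} 1≤i j≤n h+i≤j bound =
    Sum.map₂ (λ (U , U∈ , same-U) → U , subst (U ∈_) (sym (reachable-suc 1≤i j≤n h+i≤j k)) U∈ , same-U)
             (by-cases (h + i <? j))
    where
    by-cases : Dec (h + i < j) →
               Suboptimal n p t ⊎ ∃ λ U → U ∈ reachableStep p (reachable p n k) i j h × SameCostAndLeaves p (t i j h) U
    by-cases (no h+i≮j) with proj₁ run i j h 1≤i j≤n (≤-antisym h+i≤j (≮⇒≥ h+i≮j))
    ... | a , i≤a , a≤j , t≡leaf =
      inj₂ (leaf a , subst (leaf a ∈_) (sym (reachableStep-leaf h+i≮j)) (∈-map⁺ leaf (∈-interval⁺ i≤a a≤j)) ,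
            subst (λ T → SameCostAndLeaves p T (leaf a)) (sym t≡leaf) same-refl)
    by-cases (yes h+i<j) with candidate-reaches k 1≤i j≤n h+i<j bound (proj₁ (proj₂ run i j h 1≤i j≤n h+i<j))
    ... | inj₁ bad = inj₁ bad
    ... | inj₂ (C , C-candidate , same-C@(same C≡ _)) with cheapest-dichotomy {p} (∈-candidates⁺ C-candidate)
    ...   | inj₁ C-cheapest =
      let U , U∈ , same-U = distinctOutcomes-covers C-cheapest
      in inj₂ (U , subst (U ∈_) (sym (reachableStep-node h+i<j)) U∈ , same-trans same-C same-U)
    ...   | inj₂ (M , M-cheapest , M<C) =
      inj₁ (i , j , h , 1≤i , j≤n , h+i≤j ,
            cheaper-feasible⇒NotOptimal {p = p} {T₀ = t i j h}
              (candidate-feasible (reachable-feasible p n k) 1≤i j≤n h+i<j (∈-candidates⁻ (∈-cheapest⁻ M-cheapest)))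
              (subst (cost p M <_) (sym C≡) M<C))

-- The counterexample

weights : ℕ → ℕ
weights 1 = 8
weights 2 = 17
weights 3 = 3
weights 4 = 10
weights 5 = 13
weights 6 = 15
weights 7 = 1
weights 8 = 14
weights 9 = 15
weights _ = 0

-- Cost 231.  Its left subtree, for ([1,7], 1), costs 123 against 122 for the reachable one, but it leaves out
-- key 2 rather than the lighter key 6 and so weighs 2 less.
better : Tree
better = ltN 8 (eqN 6 (leaf 6) (eqN 5 (leaf 5) (eqN 4 (leaf 4) (eqN 1 (leaf 1) (eqN 3 (leaf 3) (leaf 7))))))
               (eqN 8 (leaf 8) (leaf 9))

better-feasible : Feasible 9 1 9 1 better
better-feasible = from-yes (feasible? 9 1 9 1 better)

reachable-costlier : All (λ U → cost weights better < cost weights U) (reachable weights 9 9 1 9 1)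
reachable-costlier = from-yes (all? (λ U → cost weights better <? cost weights U) (reachable weights 9 9 1 9 1))

reaches⇒suboptimal : ∀ {t} → Reaches weights 9 t 9 1 9 1 → Suboptimal 9 weights t
reaches⇒suboptimal {t} (U , U∈ , same cost≡ _) =
  1 , 9 , 1 , s≤s z≤n , ≤-refl , s≤s (s≤s z≤n) ,
  cheaper-feasible⇒NotOptimal {T₀ = t 1 9 1} better-feasible
    (subst (cost weights better <_) (sym cost≡) (All.lookup reachable-costlier U∈))

theorem2 : ∃ λ (n : ℕ) → ∃ λ (p : ℕ → ℕ) →
    (∃ λ t → SpulerRun n p t) ×
    (∀ t → SpulerRun n p t →
       ∃ λ i → ∃ λ j → ∃ λ h →
         1 ≤ i × j ≤ n × h + i ≤ j × NotOptimal n p i j h (t i j h))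
theorem2 = 9 , weights , (spuler weights 10 , spuler-run 9 weights) , λ t run →
  [ id , reaches⇒suboptimal {t} ]′
    (suboptimal-or-reaches run 9 {1} {9} {1} (s≤s z≤n) ≤-refl (s≤s (s≤s z≤n))
                           (subproblem-atMost (s≤s z≤n) ≤-refl))
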